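{- Let $\varphi\in\mathcal{L}$ be consistent and let $\mathcal{M}_\varphi\subseteq\mathcal{G}$. The following are equivalent: (I) $\mathcal{M}_\varphi$ is decreasing and contains all models of $\varphi$, and for all $\pi,\pi'\in\mathcal{G}$, if $\pi\in\mathcal{M}_\varphi$ and $\pi'\models\varphi$ then $\pi\circ\pi'\models\varphi$; (II) $\varphi$ is strongly compositional, and for all $\pi\in\mathcal{G}$, $\pi\models^*\varphi$ if and only if $\pi\in\mathcal{M}_\varphi$.
   Context: Let $V$ be a finite set of variables with finite nonempty domains. A lex model $\pi$ is a (possibly empty) sequence $(Y_1,\ge_{Y_1}),\ldots,(Y_k,\ge_{Y_k})$ of pairwise distinct variables each with a total order on its domain; $V_\pi=\{Y_1,\ldots,Y_k\}$; $\mathcal{G}$ is the set of lex models. For $\pi'=(Z_1,\ge_{Z_1}),\ldots$, $\pi\circ\pi'$ is $\pi$ followed by $\pi'$ with pairs whose variable is in $V_\pi$ deleted. $\pi'$ extends $\pi$ if $\pi'\ne\pi$ and $\pi'$ begins with $\pi$; $\pi'\sqsupseteq\pi$ means extends or equals. $\mathcal{L}$ is an arbitrary set of statements with satisfaction relation $\models\ \subseteq\mathcal{G}\times\mathcal{L}$; $\varphi$ is consistent if some $\pi$ satisfies it. $\pi\models^*\varphi$ iff some $\pi'\sqsupseteq\pi$ has $\pi'\models\varphi$. $\varphi$ is strongly compositional if for all $\pi,\pi'$, $\pi\models^*\varphi$ and $\pi'\models\varphi$ imply $\pi\circ\pi'\models\varphi$. A set $\mathcal{M}\subseteq\mathcal{G}$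 is decreasing if whenever $\pi'$ extends $\pi$ and $\pi'\in\mathcal{M}$, then $\pi\in\mathcal{M}$; $\mathcal{M}$ contains all models of $\varphi$ if $\pi\models\varphi$ implies $\pi\in\mathcal{M}$. -}

module Defs where

open import Data.Nat using (ℕ; _≤_)
open import Data.Fin using (Fin)
import Data.Fin.Properties as FinP
open import Data.List using (List; []; _∷_; _++_; map; filter; length)
open import Data.List.Relation.Unary.All using (All)
open import Data.List.Relation.Unary.Unique.Propositional using (Unique)
import Data.List.Membership.DecPropositional as DecMem
open import Data.Product using (Σ; ∃; _×_; _,_; proj₁; proj₂)
open import Relation.Binary.PropositionalEquality using (_≡_; _≢_)
open import Relation.Nullary using (¬?)

-- Variables are Fin n; variable i has domain Fin (d i).
-- A total order on the domain Fin k is represented by the list of all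
-- domain values from best to worst (duplicate-free, of length k).
module _ (n : ℕ) (d : Fin n → ℕ) where

  Entry : Set
  Entry = Σ (Fin n) (λ i → List (Fin (d i)))

  Raw : Set
  Raw = List Entry

  open DecMem (FinP._≟_ {n}) using (_∈?_)

  vars : Raw → List (Fin n)
  vars π = map proj₁ π

  IsTotalOrderList : (i : Fin n) → List (Fin (d i)) → Set
  IsTotalOrderList i o = Unique o × length o ≡ d i

  IsLexModel : Raw → Set
  IsLexModel π = Unique (vars π) × All (λ e → IsTotalOrderList (proj₁ e) (proj₂ e)) π

  _∘ₗ_ : Raw → Raw → Raw
  π ∘ₗ π' = π ++ filter (λ e → ¬? (proj₁ e ∈? vars π)) π'

  _⊒_ : Raw → Raw → Set
  π' ⊒ π = ∃ λ s → π' ≡ π ++ s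

  _Extends_ : Raw → Raw → Set
  π' Extends π = π' ≢ π × π' ⊒ π

  module _ {L : Set} (_⊨_ : Raw → L → Set) where

    Consistent : L → Set
    Consistent φ = ∃ λ π → IsLexModel π × π ⊨ φ

    _⊨*_ : Raw → L → Set
    π ⊨* φ = ∃ λ π' → IsLexModel π' × π' ⊒ π × π' ⊨ φ

    StronglyCompositional : L → Set
    StronglyCompositional φ = ∀ π π' → IsLexModel π → IsLexModel π' →
      π ⊨* φ → π' ⊨ φ → (π ∘ₗ π') ⊨ φ

    ContainsAllModels : (Raw → Set) → L → Set
    ContainsAllModels M φ = ∀ π → IsLexModel π → π ⊨ φ → M π

  Decreasing : (Raw → Set) → Set
  Decreasing M = ∀ π π' → IsLexModel π → IsLexModel π' →
    π' Extends π → M π' → M π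

{-# OPTIONS --safe #-}
-- Both conditions say that M is the set of lex models that extend to a model of φ.
-- Models of φ satisfy ⊨*, and ⊨* is closed under taking prefixes; so a decreasing M
-- containing every model of φ contains every π with π ⊨* φ. Conversely, if M π then,
-- for a model π₀ of φ (which exists by consistency), π ∘ π₀ is a model of φ extending
-- π, so π ⊨* φ. With M and ⊨* identified, the composition conditions in (I) and (II)
-- coincide.
module Submission where

open import Defs
open import Data.Nat using (ℕ; _≤_)
open import Data.Fin using (Fin)
import Data.Fin.Properties as Fin
open import Data.List using (List; []; _∷_; _++_; map; filter)
open import Data.List.Properties using (++-identityʳ; ++-identityʳ-unique; ++-assoc; map-++)
import Data.List.Relation.Unary.All.Properties as All
import Data.List.Relation.Unary.AllPairs.Properties as AllPairs
open import Data.List.Relation.Unary.Unique.Propositional using (Unique)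
import Data.List.Relation.Unary.Unique.Propositional.Properties as Unique
open import Data.List.Relation.Binary.Disjoint.Propositional using (Disjoint)
open import Data.List.Membership.Propositional.Properties using (∈-map⁻; ∈-filter⁻)
import Data.List.Membership.DecPropositional as DecMembership
open import Data.Product using (_×_; _,_; proj₁; proj₂)
open import Data.Sum using (_⊎_; inj₁; inj₂)
open import Function.Bundles using (_⇔_; mk⇔)
open import Relation.Binary.PropositionalEquality using (_≡_; _≢_; refl; sym; subst)
open import Relation.Unary using (Decidable)
open import Relation.Nullary using (¬?)

Unique-map-filter⁺ : ∀ {A B : Set} {P : A → Set} (f : A → B) (P? : Decidable P) {xs : List A} →
                     Unique (map f xs) → Unique (map f (filter P? xs))
Unique-map-filter⁺ f P? u = AllPairs.map⁺ (AllPairs.filter⁺ P? (AllPairs.map⁻ u))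

module _ {n : ℕ} {d : Fin n → ℕ} where

  open DecMembership (Fin._≟_ {n}) using (_∈?_)

  ∘ₗ-preserves-IsLexModel : ∀ {π π'} → IsLexModel n d π → IsLexModel n d π' →
                            IsLexModel n d (_∘ₗ_ n d π π')
  ∘ₗ-preserves-IsLexModel {π} {π'} (π-unique , π-orders) (π'-unique , π'-orders) =
    subst Unique (sym (map-++ proj₁ π kept)) (Unique.++⁺ π-unique kept-unique disjoint) ,
    All.++⁺ π-orders (All.filter⁺ fresh? π'-orders)
    where
    fresh? = λ (e : Entry n d) → ¬? (proj₁ e ∈? vars n d π)
    kept = filter fresh? π'

    kept-unique : Unique (vars n d kept)
    kept-unique = Unique-map-filter⁺ proj₁ fresh? π'-unique

    disjoint : Disjoint (vars n d π) (vars n d kept)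
    disjoint (v∈π , v∈kept) with ∈-map⁻ proj₁ v∈kept
    ... | e , e∈kept , refl = proj₂ (∈-filter⁻ fresh? {xs = π'} e∈kept) v∈π

  ∘ₗ-⊒ : ∀ π π' → _⊒_ n d (_∘ₗ_ n d π π') π
  ∘ₗ-⊒ π π' = _ , refl

  ⊒-refl : ∀ π → _⊒_ n d π π
  ⊒-refl π = [] , sym (++-identityʳ π)

  ⊒-trans : ∀ {π π' π''} → _⊒_ n d π'' π' → _⊒_ n d π' π → _⊒_ n d π'' π
  ⊒-trans {π} (t , refl) (s , refl) = s ++ t , ++-assoc π s t

  ⊒⇒≡⊎Extends : ∀ {π π'} → _⊒_ n d π' π → π' ≡ π ⊎ _Extends_ n d π' π
  ⊒⇒≡⊎Extends {π} ([] , refl) = inj₁ (++-identityʳ π)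
  ⊒⇒≡⊎Extends {π} (x ∷ s , refl) = inj₂ (π++x∷s≢π , (x ∷ s , refl))
    where
    x∷s≢[] : x ∷ s ≢ []
    x∷s≢[] ()

    π++x∷s≢π : π ++ x ∷ s ≢ π
    π++x∷s≢π eq = x∷s≢[] (++-identityʳ-unique π (sym eq))

  module _ {L : Set} (_⊨_ : Raw n d → L → Set) {φ : L} where

    ⊨⇒⊨* : ∀ {π} → IsLexModel n d π → π ⊨ φ → _⊨*_ n d _⊨_ π φ
    ⊨⇒⊨* {π} π-lex π⊨φ = π , π-lex , ⊒-refl π , π⊨φ

    ⊨*-antitone : ∀ {π π'} → _⊒_ n d π' π → _⊨*_ n d _⊨_ π' φ → _⊨*_ n d _⊨_ π φ
    ⊨*-antitone π'⊒π (π'' , π''-lex , π''⊒π' , π''⊨φ) = π'' , π''-lex , ⊒-trans π''⊒π' π'⊒π , π''⊨φ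

    ∘ₗ⊨⇒⊨* : ∀ {π π'} → IsLexModel n d π → IsLexModel n d π' →
             _∘ₗ_ n d π π' ⊨ φ → _⊨*_ n d _⊨_ π φ
    ∘ₗ⊨⇒⊨* {π} {π'} π-lex π'-lex π∘π'⊨φ =
      _ , ∘ₗ-preserves-IsLexModel π-lex π'-lex , ∘ₗ-⊒ π π' , π∘π'⊨φ

    decreasing-contains-⊨* : ∀ {M : Raw n d → Set} →
                             Decreasing n d M → ContainsAllModels n d _⊨_ M φ →
                             ∀ {π} → IsLexModel n d π → _⊨*_ n d _⊨_ π φ → M π
    decreasing-contains-⊨* M-decreasing M-models {π} π-lex (π' , π'-lex , π'⊒π , π'⊨φ)
      with ⊒⇒≡⊎Extends π'⊒π
    ... | inj₁ refl = M-models π' π'-lex π'⊨φ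
    ... | inj₂ π'-extends = M-decreasing π π' π-lex π'-lex π'-extends (M-models π' π'-lex π'⊨φ)

    ∘ₗ-closed-⊆-⊨* : Consistent n d _⊨_ φ → (M : Raw n d → Set) →
                     (∀ π π' → IsLexModel n d π → IsLexModel n d π' → M π → π' ⊨ φ → _∘ₗ_ n d π π' ⊨ φ) →
                     ∀ {π} → IsLexModel n d π → M π → _⊨*_ n d _⊨_ π φ
    ∘ₗ-closed-⊆-⊨* (π₀ , π₀-lex , π₀⊨φ) M M-∘ₗ {π} π-lex Mπ =
      ∘ₗ⊨⇒⊨* π-lex π₀-lex (M-∘ₗ π π₀ π-lex π₀-lex Mπ π₀⊨φ)

proposition4 : (n : ℕ) (d : Fin n → ℕ) → (∀ i → 1 ≤ d i) →
    {L : Set} (_⊨_ : Raw n d → L → Set) (φ : L) →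
    Consistent n d _⊨_ φ →
    (M : Raw n d → Set) →
    (Decreasing n d M × ContainsAllModels n d _⊨_ M φ
      × (∀ π π' → IsLexModel n d π → IsLexModel n d π' →
           M π → π' ⊨ φ → _⊨_ (_∘ₗ_ n d π π') φ))
    ⇔
    (StronglyCompositional n d _⊨_ φ
      × (∀ π → IsLexModel n d π → (_⊨*_ n d _⊨_ π φ → M π) × (M π → _⊨*_ n d _⊨_ π φ)))
proposition4 n d _ _⊨_ φ consistent M = mk⇔
  (λ (M-decreasing , M-models , M-∘ₗ) →
     let ⊨*⇒M = decreasing-contains-⊨* _⊨_ M-decreasing M-models in
     (λ π π' π-lex π'-lex π⊨*φ → M-∘ₗ π π' π-lex π'-lex (⊨*⇒M π-lex π⊨*φ)) ,
     (λ π π-lex → ⊨*⇒M π-lex , ∘ₗ-closed-⊆-⊨* _⊨_ consistent M M-∘ₗ π-lex))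
  (λ (strongly-compositional , M⇔⊨*) →
     (λ π π' π-lex π'-lex (_ , π'⊒π) Mπ' →
        proj₁ (M⇔⊨* π π-lex) (⊨*-antitone _⊨_ π'⊒π (proj₂ (M⇔⊨* π' π'-lex) Mπ'))) ,
     (λ π π-lex π⊨φ → proj₁ (M⇔⊨* π π-lex) (⊨⇒⊨* _⊨_ π-lex π⊨φ)) ,
     (λ π π' π-lex π'-lex Mπ π'⊨φ →
        strongly-compositional π π' π-lex π'-lex (proj₂ (M⇔⊨* π π-lex) Mπ) π'⊨φ))
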